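{- For every positive integer $r$, if $\pi$ is the canonical $r\times r$-grid permutation, then $w(\pi)=r$.
   Context: The canonical $r\times r$-grid permutation is the permutation (pair $(S,P)$ with $P:S\to\mathbb{N}^2$ injective) whose point set is $\{((j-1)r+(r-i+1),\,(i-1)r+j):1\le i\le r,\ 1\le j\le r\}$. Intervals are discrete; a rectangle is $R=I_1(R)\times I_2(R)$ with intervals $I_1(R),I_2(R)$. A rectangle family is $\mathcal{R}=(S,R)$ assigning a rectangle to each index of a finite $S\subseteq\mathbb{N}$; a permutation is viewed as the family $R(i)=\{P(i)\}$. $\mathcal{R}[i,j\to k]$ ($k\notin S$) replaces $R(i),R(j)$ by their bounding box indexed $k$. A decomposition of $\pi$ is $(\mathcal{R}_0,\dots,\mathcal{R}_s)$ with $\mathcal{R}_0=\pi$, $\max S<k_1<\dots<k_s$, $\mathcal{R}_p=\mathcal{R}_{p-1}[i,j\to k_p]$ for some $i,j$, $|\mathcal{R}_s|=1$. $R,R'$ $\alpha$-view each other if $I_\alpha(R)\cap I_\alpha(R')\ne\emptyset$; $\mathrm{view}(\mathcal{R},i)=\max_{\alpha\in\{1,2\}}|\{j\ne i:R(i),R(j)\ \alpha\text{ -view each other}\}|$; $\mathcal{R}$ is $d$-wide if $\mathrm{view}(\mathcal{R},i)<d$ for all $i$; a decomposition is $d$-wide if all its families are; $w(\pi)$ is the minimum $d$ such that $\pi$ has a $d$-wide decomposition. -}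

module Defs where

open import Data.Nat using (ℕ; zero; suc; _+_; _*_; _∸_; _≤_; _<_; _⊔_; _⊓_; _≤ᵇ_; NonZero)
open import Data.Nat.DivMod using (_/_; _%_)
open import Data.Bool using (Bool; true; false; _∧_; not)
open import Data.List using (List; []; _∷_; map; filterᵇ; length; upTo; foldr)
open import Data.List.Membership.Propositional using (_∈_)
open import Data.List.Relation.Binary.Permutation.Propositional using (_↭_)
open import Data.Product using (_×_; _,_; proj₁; proj₂)
open import Relation.Binary.PropositionalEquality using (_≡_; _≢_)
open import Relation.Nullary using (¬_)
open import Relation.Nullary.Decidable using (⌊_⌋)
open import Data.Nat using (_≟_)

-- A discrete interval [lo , hi] = { x ∈ ℕ : lo ≤ x ≤ hi }.
record Interval : Set where
  constructor [_,_]
  field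
    lo : ℕ
    hi : ℕ
open Interval public

-- The intersection of [a,b] and [a',b'] is [max a a', min b b'];
-- it is nonempty iff max a a' ≤ min b b'.
meets : Interval → Interval → Bool
meets I J = (lo I ⊔ lo J) ≤ᵇ (hi I ⊓ hi J)

hull : Interval → Interval → Interval
hull I J = [ lo I ⊓ lo J , hi I ⊔ hi J ]

Rect : Set
Rect = Interval × Interval

I₁ I₂ : Rect → Interval
I₁ = proj₁
I₂ = proj₂

bbox : Rect → Rect → Rect
bbox R R' = hull (I₁ R) (I₁ R') , hull (I₂ R) (I₂ R')

-- A rectangle family (S , R): S is a finite set of indices (given as a list),
-- R assigns a rectangle to each index (values outside S are irrelevant).
record Family : Set where
  constructor fam
  field
    dom  : List ℕ
    rect : ℕ → Rect
open Family public

-- A permutation (S , P) viewed as the rectangle family R(i) = {P(i)}.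
point : ℕ × ℕ → Rect
point (x , y) = [ x , x ] , [ y , y ]

permFamily : List ℕ → (ℕ → ℕ × ℕ) → Family
permFamily S P = fam S (λ i → point (P i))

keepOthers : ℕ → ℕ → ℕ → Bool
keepOthers i j l = not ⌊ l ≟ i ⌋ ∧ not ⌊ l ≟ j ⌋

record Merge (F : Family) (i j k : ℕ) (G : Family) : Set where
  field
    i∈S   : i ∈ dom F
    j∈S   : j ∈ dom F
    i≢j   : i ≢ j
    k∉S   : ¬ (k ∈ dom F)
    domG  : dom G ↭ (k ∷ filterᵇ (keepOthers i j) (dom F))
    rectk : rect G k ≡ bbox (rect F i) (rect F j)
    rectl : ∀ l → l ∈ dom G → l ≢ k → rect G l ≡ rect F l

countView : (Rect → Interval) → Family → ℕ → ℕ
countView Iα F i =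
  length (filterᵇ (λ j → not ⌊ j ≟ i ⌋ ∧ meets (Iα (rect F i)) (Iα (rect F j))) (dom F))

view : Family → ℕ → ℕ
view F i = countView I₁ F i ⊔ countView I₂ F i

Wide : ℕ → Family → Set
Wide d F = ∀ i → i ∈ dom F → view F i < d

-- d-wide decompositions continuing from family F, where every newly
-- introduced index must exceed m (this encodes max S < k₁ < … < kₛ).
data WideDecompFrom (d : ℕ) : ℕ → Family → Set where
  done : ∀ {m F} → Wide d F → length (dom F) ≡ 1 → WideDecompFrom d m F
  step : ∀ {m F G} i j k → Wide d F → m < k → Merge F i j k G →
         WideDecompFrom d k G → WideDecompFrom d m F

maxList : List ℕ → ℕ
maxList = foldr _⊔_ 0

HasWideDecomp : ℕ → Family → Set
HasWideDecomp d F = WideDecompFrom d (maxList (dom F)) F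

WidthIs : Family → ℕ → Set
WidthIs F d = HasWideDecomp d F × (∀ d' → HasWideDecomp d' F → d ≤ d')

-- The canonical r×r-grid permutation, with S = {1, …, r²}; the point with
-- index n = (i-1)r + j (1 ≤ i,j ≤ r) is ((j-1)r + (r-i+1), (i-1)r + j).
gridS : ℕ → List ℕ
gridS r = map suc (upTo (r * r))

gridP : (r : ℕ) → .{{NonZero r}} → ℕ → ℕ × ℕ
gridP r n = ((n ∸ 1) % r) * r + (r ∸ (n ∸ 1) / r) , n

grid : (r : ℕ) → .{{NonZero r}} → Family
grid r = permFamily (gridS r) (gridP r)

module Submission where

-- Two distinct grid points are at distance at least r along one of
-- the axes (Grid.separated), and along each axis the coordinates of the grid points
-- are exactly 1, …, r². So whichever two points the first merge of a decomposition
-- joins, the new bounding box meets, along such an axis, the r − 1 points strictly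
-- between them (MergedPoints.views-gap): its view is at least r − 1, forcing d ≥ r.
--
-- Sweep the points by increasing x-coordinate: at stage t the family
-- consists of r "chains" (bounding boxes of the points of one row block met so far)
-- and the points not yet reached; the next step adds the next point to the chain of
-- its row block. An invariant (Grid.Invariant) describes every stage exactly. From
-- it, distinct members never share a y-coordinate and only chains share
-- x-coordinates, so every stage is r-wide; the last r chains are merged in any order.

open import Defs
open import Data.Nat using (ℕ; NonZero)
open import Data.Nat using (zero; suc; _+_; _*_; _∸_; _≤_; _<_; _⊔_; _⊓_; _≤ᵇ_; z≤n; s≤s; s≤s⁻¹; z<s; _≟_; _<?_; ≢-nonZero⁻¹)
open import Data.Nat.Properties
open import Data.Nat.DivMod
open import Data.Nat.Divisibility using (n∣m*n)
open import Data.Bool using (Bool; T; not; _∧_; if_then_else_)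
open import Data.Bool.Properties using (T-∧)
open import Data.List using (List; []; _∷_; _++_; map; filterᵇ; length; upTo)
open import Data.List.Properties using (length-map; length-upTo; filter-reject; filter-all)
open import Data.List.Membership.Propositional using (_∈_; _∉_)
open import Data.List.Membership.Propositional.Properties
  using (∈-∃++; ∈-++⁻; ∈-++⁺ˡ; ∈-++⁺ʳ; ∈-map⁺; ∈-map⁻; ∈-upTo⁺; ∈-upTo⁻; ∈-filter⁺; ∈-filter⁻)
open import Data.List.Relation.Binary.Subset.Propositional using (_⊆_)
open import Data.List.Relation.Binary.Permutation.Propositional using (↭-refl; ↭-sym)
open import Data.List.Relation.Binary.Permutation.Propositional.Properties using (∈-resp-↭; ↭-length; shift)
open import Data.List.Relation.Unary.All as All using (All; []; _∷_)
open import Data.List.Relation.Unary.Any using (here; there)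
open import Data.List.Relation.Unary.Unique.Propositional using (Unique; []; _∷_)
import Data.List.Relation.Unary.Unique.Propositional.Properties as Unique
open import Data.Product using (_×_; _,_; proj₁; proj₂; Σ; ∃-syntax)
open import Data.Sum using (_⊎_; inj₁; inj₂)
open import Function using (_∘_; Equivalence)
open import Relation.Binary.PropositionalEquality using (_≡_; _≢_; refl; sym; trans; cong; cong₂; subst; subst₂; module ≡-Reasoning)
open import Relation.Nullary using (¬_; yes; no; contradiction)
open import Relation.Binary using (tri<; tri≈; tri>)
open import Relation.Nullary.Decidable using (⌊_⌋; T?; fromWitnessFalse; toWitnessFalse)

unique-⊆-length : {A : Set} {xs ys : List A} → Unique xs → xs ⊆ ys → length xs ≤ length ys
unique-⊆-length {xs = []} _ _ = z≤n
unique-⊆-length {xs = x ∷ xs} u@(_ ∷ u′) sub with ∈-∃++ (sub (here refl))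
... | ys₁ , ys₂ , refl = begin
    suc (length xs)           ≤⟨ s≤s (unique-⊆-length u′ sub′) ⟩
    suc (length (ys₁ ++ ys₂)) ≡⟨ ↭-length (shift x ys₁ ys₂) ⟨
    length (ys₁ ++ x ∷ ys₂)   ∎
  where
    open ≤-Reasoning
    -- removing the occurrence of x from ys keeps the rest of xs, since x ∉ xs
    sub′ : xs ⊆ ys₁ ++ ys₂
    sub′ z∈xs with ∈-++⁻ ys₁ (sub (there z∈xs))
    ... | inj₁ p          = ∈-++⁺ˡ p
    ... | inj₂ (here refl) = contradiction z∈xs (Unique.Unique[x∷xs]⇒x∉xs u)
    ... | inj₂ (there p)  = ∈-++⁺ʳ ys₁ p

meets⁻ : ∀ I J → T (meets I J) → lo I ≤ hi J × lo J ≤ hi I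
meets⁻ I J h =
  ≤-trans (m≤m⊔n (lo I) (lo J)) (≤-trans common (m⊓n≤n (hi I) (hi J))) ,
  ≤-trans (m≤n⊔m (lo I) (lo J)) (≤-trans common (m⊓n≤m (hi I) (hi J)))
  where
    common : lo I ⊔ lo J ≤ hi I ⊓ hi J
    common = ≤ᵇ⇒≤ _ _ h

meets⁺ : ∀ I J → lo I ≤ hi I → lo J ≤ hi J → lo I ≤ hi J → lo J ≤ hi I → T (meets I J)
meets⁺ I J I≠∅ J≠∅ IJ JI = ≤⇒≤ᵇ (⊔-lub (⊓-glb I≠∅ IJ) (⊓-glb JI J≠∅))

meets-sym : ∀ I J → T (meets I J) → T (meets J I)
meets-sym I J h = subst T (cong₂ (λ a b → a ≤ᵇ b) (⊔-comm (lo I) (lo J)) (⊓-comm (hi I) (hi J))) h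

hull-right : ∀ {a b a′ b′} → a ≤ a′ → b ≤ b′ → hull [ a , b ] [ a′ , b′ ] ≡ [ a , b′ ]
hull-right a≤a′ b≤b′ = cong₂ [_,_] (m≤n⇒m⊓n≡m a≤a′) (m≤n⇒m⊔n≡n b≤b′)

points-meet : ∀ a b → T (meets [ a , a ] [ b , b ]) → a ≡ b
points-meet a b h = let (a≤b , b≤a) = meets⁻ [ a , a ] [ b , b ] h in ≤-antisym a≤b b≤a

≢⇒≠ᵇ : ∀ {i j} → j ≢ i → T (not ⌊ j ≟ i ⌋)
≢⇒≠ᵇ {i} {j} = fromWitnessFalse {a? = j ≟ i}

≠ᵇ⇒≢ : ∀ {i j} → T (not ⌊ j ≟ i ⌋) → j ≢ i
≠ᵇ⇒≢ {i} {j} = toWitnessFalse {a? = j ≟ i}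

data Axis : Set where
  horizontal vertical : Axis

side : Axis → Rect → Interval
side horizontal = I₁
side vertical   = I₂

coord : Axis → ℕ × ℕ → ℕ
coord horizontal = proj₁
coord vertical   = proj₂

countView≤view : ∀ α F i → countView (side α) F i ≤ view F i
countView≤view horizontal F i = m≤m⊔n _ _
countView≤view vertical   F i = m≤n⊔m _ _

-- The α-viewers of i: the other members of F whose α-interval meets that of i.
-- countView Iα F i is by definition the length of this list.
sees : (Rect → Interval) → Family → ℕ → ℕ → Bool
sees Iα F i j = not ⌊ j ≟ i ⌋ ∧ meets (Iα (rect F i)) (Iα (rect F j))

viewers : (Rect → Interval) → Family → ℕ → List ℕ
viewers Iα F i = filterᵇ (sees Iα F i) (dom F)

module _ {Iα : Rect → Interval} {F : Family} {i : ℕ} where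

  ∈-viewers⁻ : ∀ {j} → j ∈ viewers Iα F i →
               j ∈ dom F × j ≢ i × T (meets (Iα (rect F i)) (Iα (rect F j)))
  ∈-viewers⁻ {j} j∈ with ∈-filter⁻ (T? ∘ sees Iα F i) j∈
  ... | j∈F , h with Equivalence.to (T-∧ {not ⌊ j ≟ i ⌋}) h
  ... | j≢i , met = j∈F , ≠ᵇ⇒≢ j≢i , met

  ∈-viewers⁺ : ∀ {j} → j ∈ dom F → j ≢ i → T (meets (Iα (rect F i)) (Iα (rect F j))) →
               j ∈ viewers Iα F i
  ∈-viewers⁺ j∈F j≢i met = ∈-filter⁺ (T? ∘ sees Iα F i) j∈F (Equivalence.from T-∧ (≢⇒≠ᵇ j≢i , met))

keepOthers⁺ : ∀ {i j l} → l ≢ i → l ≢ j → T (keepOthers i j l)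
keepOthers⁺ l≢i l≢j = Equivalence.from T-∧ (≢⇒≠ᵇ l≢i , ≢⇒≠ᵇ l≢j)

keepOthers⁻ : ∀ {i j l} → T (keepOthers i j l) → l ≢ i × l ≢ j
keepOthers⁻ {i} {j} {l} h with Equivalence.to (T-∧ {not ⌊ l ≟ i ⌋}) h
... | l≢i , l≢j = ≠ᵇ⇒≢ l≢i , ≠ᵇ⇒≢ {j} l≢j

merge : Family → ℕ → ℕ → ℕ → Family
merge F i j k = fam (k ∷ filterᵇ (keepOthers i j) (dom F)) mergedRect
  where
    mergedRect : ℕ → Rect
    mergedRect l = if ⌊ l ≟ k ⌋ then bbox (rect F i) (rect F j) else rect F l

merge-rect-new : ∀ F i j k → rect (merge F i j k) k ≡ bbox (rect F i) (rect F j)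
merge-rect-new F i j k with k ≟ k
... | yes _   = refl
... | no k≢k = contradiction refl k≢k

merge-rect-old : ∀ F i j k {l} → l ≢ k → rect (merge F i j k) l ≡ rect F l
merge-rect-old F i j k {l} l≢k with l ≟ k
... | yes l≡k = contradiction l≡k l≢k
... | no _    = refl

merge-isMerge : ∀ {F i j k} → i ∈ dom F → j ∈ dom F → i ≢ j → k ∉ dom F →
                Merge F i j k (merge F i j k)
merge-isMerge {F} {i} {j} {k} i∈F j∈F i≢j k∉F = record
  { i∈S = i∈F ; j∈S = j∈F ; i≢j = i≢j ; k∉S = k∉F ; domG = ↭-refl
  ; rectk = merge-rect-new F i j k
  ; rectl = λ _ _ l≢k → merge-rect-old F i j k l≢k }

countView-< : ∀ {Iα F i ys} → Unique (dom F) → i ∈ ys → viewers Iα F i ⊆ ys →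
              countView Iα F i < length ys
countView-< {Iα} {F} {i} {ys} u i∈ys vs⊆ys = unique-⊆-length (i∉vs ∷ Unique.filter⁺ (T? ∘ sees Iα F i) u) i∷vs⊆ys
  where
    i∉vs : All (i ≢_) (viewers Iα F i)
    i∉vs = All.tabulate (λ j∈vs i≡j → proj₁ (proj₂ (∈-viewers⁻ {Iα} {F} {i} j∈vs)) (sym i≡j))
    i∷vs⊆ys : i ∷ viewers Iα F i ⊆ ys
    i∷vs⊆ys (here refl) = i∈ys
    i∷vs⊆ys (there p)   = vs⊆ys p

wide-if-small : ∀ {d} F → Unique (dom F) → length (dom F) ≤ d → Wide d F
wide-if-small {d} F u small i i∈F = ⊔-lub (fewer I₁) (fewer I₂)
  where
    fewer : ∀ Iα → countView Iα F i < d
    fewer Iα = <-≤-trans (countView-< {Iα} {F} {i} u i∈F (λ v∈ → proj₁ (∈-viewers⁻ {Iα} {F} {i} v∈))) small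

keepOthers-front : ∀ {i j rest} → Unique (i ∷ j ∷ rest) → filterᵇ (keepOthers i j) (i ∷ j ∷ rest) ≡ rest
keepOthers-front {i} {j} {rest} ((_ ∷ i∉rest) ∷ j∉rest ∷ _) = begin
    filterᵇ (keepOthers i j) (i ∷ j ∷ rest)
      ≡⟨ filter-reject (T? ∘ keepOthers i j) {i} (λ h → proj₁ (keepOthers⁻ {i} {j} h) refl) ⟩
    filterᵇ (keepOthers i j) (j ∷ rest)
      ≡⟨ filter-reject (T? ∘ keepOthers i j) {j} (λ h → proj₂ (keepOthers⁻ {i} {j} h) refl) ⟩
    filterᵇ (keepOthers i j) rest
      ≡⟨ filter-all (T? ∘ keepOthers i j) (All.zipWith (λ (i≢l , j≢l) → keepOthers⁺ (i≢l ∘ sym) (j≢l ∘ sym))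
                                                          (i∉rest , j∉rest)) ⟩
    rest ∎
  where open ≡-Reasoning

merge-front : ∀ {d} m R i rest → Unique (i ∷ rest) → length (i ∷ rest) ≤ d →
              (∀ {l} → l ∈ i ∷ rest → l ≤ m) → WideDecompFrom d m (fam (i ∷ rest) R)
merge-front m R i [] u small _ = done (wide-if-small (fam (i ∷ []) R) u small) refl
merge-front {d} m R i (j ∷ rest) u@((i≢j ∷ _) ∷ _ ∷ u-rest) small bounded =
  step i j (suc m) (wide-if-small F u small) ≤-refl
    (merge-isMerge (here refl) (there (here refl)) i≢j fresh)
    (subst (λ D → WideDecompFrom d (suc m) (fam (suc m ∷ D) R′)) (sym (keepOthers-front u))
       (merge-front (suc m) R′ (suc m) rest u′ (≤-trans (n≤1+n _) small) bounded′))
  where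
    F : Family
    F = fam (i ∷ j ∷ rest) R
    R′ : ℕ → Rect
    R′ = rect (merge F i j (suc m))
    fresh : suc m ∉ i ∷ j ∷ rest
    fresh p = <-irrefl refl (bounded p)
    u′ : Unique (suc m ∷ rest)
    u′ = All.tabulate (λ l∈rest m≡l → fresh (there (there (subst (_∈ rest) (sym m≡l) l∈rest)))) ∷ u-rest
    bounded′ : ∀ {l} → l ∈ suc m ∷ rest → l ≤ suc m
    bounded′ (here refl) = ≤-refl
    bounded′ (there p)   = m≤n⇒m≤1+n (bounded (there (there p)))

finish : ∀ {d} m F {i} → i ∈ dom F → Unique (dom F) → length (dom F) ≤ d →
         (∀ {l} → l ∈ dom F → l ≤ m) → WideDecompFrom d m F
finish m (fam (i ∷ rest) R) _ = merge-front m R i rest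

lower-start : ∀ {d m m′ F} → m′ ≤ m → WideDecompFrom d m F → WideDecompFrom d m′ F
lower-start _ (done w one)              = done w one
lower-start m′≤m (step i j k w m<k M D) = step i j k w (≤-<-trans m′≤m m<k) M D

maxList-≤ : ∀ {b} xs → (∀ {x} → x ∈ xs → x ≤ b) → maxList xs ≤ b
maxList-≤ []       _ = z≤n
maxList-≤ (x ∷ xs) h = ⊔-lub (h (here refl)) (maxList-≤ xs (h ∘ there))

initial-wide : ∀ {d m F} → WideDecompFrom d m F → Wide d F
initial-wide (done w _)           = w
initial-wide (step _ _ _ w _ _ _) = w

side-point : ∀ α p → side α (point p) ≡ [ coord α p , coord α p ]
side-point horizontal _ = refl
side-point vertical   _ = refl

side-bbox : ∀ α R R′ → side α (bbox R R′) ≡ hull (side α R) (side α R′)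
side-bbox horizontal _ _ = refl
side-bbox vertical   _ _ = refl

inside-hull-≢ : ∀ {a b c} → a ⊓ b < c → c < a ⊔ b → c ≢ a
inside-hull-≢ {a} {b} low<c c<high refl with ≤-total a b
... | inj₁ a≤b = <-irrefl (m≤n⇒m⊓n≡m a≤b) low<c
... | inj₂ b≤a = <-irrefl (sym (m≥n⇒m⊔n≡m b≤a)) c<high

module MergedPoints {S P i j k G} (M : Merge (permFamily S P) i j k G) (α : Axis) where
  open Merge M

  c : ℕ → ℕ
  c l = coord α (P l)

  low high : ℕ
  low  = c i ⊓ c j
  high = c i ⊔ c j

  sees-between : ∀ {l} → l ∈ S → low < c l → c l < high → l ∈ viewers (side α) G k
  sees-between {l} l∈S low< <high = ∈-viewers⁺ {side α} {G} {k} l∈G l≢k met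
    where
      l≢i : l ≢ i
      l≢i refl = inside-hull-≢ low< <high refl
      l≢j : l ≢ j
      l≢j refl = inside-hull-≢ (subst (_< c l) (⊓-comm (c i) (c j)) low<)
                               (subst (c l <_) (⊔-comm (c i) (c j)) <high) refl
      l≢k : l ≢ k
      l≢k refl = k∉S l∈S
      l∈G : l ∈ dom G
      l∈G = ∈-resp-↭ (↭-sym domG) (there (∈-filter⁺ (T? ∘ keepOthers i j) l∈S (keepOthers⁺ l≢i l≢j)))
      met : T (meets (side α (rect G k)) (side α (rect G l)))
      met rewrite rectk | rectl l l∈G l≢k | side-bbox α (point (P i)) (point (P j))
                | side-point α (P i) | side-point α (P j) | side-point α (P l) =
        meets⁺ [ low , high ] [ c l , c l ] (m⊓n≤m⊔n (c i) (c j)) ≤-refl (<⇒≤ low<) (<⇒≤ <high)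

  views-gap : ∀ g → low + g < high → (∀ {v} → low < v → v < high → ∃[ l ] (l ∈ S × c l ≡ v)) →
              g ≤ countView (side α) G k
  views-gap g room fill = begin
      g                                        ≡⟨ trans (length-map _ (upTo g)) (length-upTo g) ⟨
      length gap                               ≤⟨ unique-⊆-length gap-unique gap⊆ ⟩
      length (map c (viewers (side α) G k))    ≡⟨ length-map c (viewers (side α) G k) ⟩
      countView (side α) G k                   ∎
    where
      open ≤-Reasoning
      gap : List ℕ
      gap = map (λ t → suc (low + t)) (upTo g)
      gap-unique : Unique gap
      gap-unique = Unique.map⁺ (λ e → +-cancelˡ-≡ low _ _ (suc-injective e)) (Unique.upTo⁺ g)
      in-gap : ∀ {v} → v ∈ gap → low < v × v < high
      in-gap v∈gap with ∈-map⁻ _ v∈gap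
      ... | t , t<g , refl = s≤s (m≤m+n low t) , <-≤-trans (s≤s (+-monoʳ-< low (∈-upTo⁻ t<g))) room
      gap⊆ : gap ⊆ map c (viewers (side α) G k)
      gap⊆ v∈gap with in-gap v∈gap
      ... | low<v , v<high with fill low<v v<high
      ... | l , l∈S , refl = ∈-map⁺ c (sees-between l∈S low<v v<high)

-- The canonical r × r grid, r = r′ + 1, N = r². Its points are best addressed by
-- their x-rank m < N, the point with x-coordinate m + 1. Writing m = a·r + s with
-- a = m / r and s = m % r, this point lies in row block r′ − s at position a, so
-- its y-coordinate, which is also its index, is (r′ − s)·r + a + 1.
module Grid (r′ : ℕ) where

  r N : ℕ
  r = suc r′
  N = r * r

  divmod : ∀ m → m ≡ m / r * r + m % r
  divmod m = trans (m≡m%n+[m/n]*n m r) (+-comm (m % r) _)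

  block-/ : ∀ b {o} → o < r → (b * r + o) / r ≡ b
  block-/ b {o} o<r = begin
      (b * r + o) / r    ≡⟨ +-distrib-/-∣ˡ o (n∣m*n b) ⟩
      b * r / r + o / r  ≡⟨ cong₂ _+_ (m*n/n≡m b r) (m<n⇒m/n≡0 o<r) ⟩
      b + 0              ≡⟨ +-identityʳ b ⟩
      b                  ∎
    where open ≡-Reasoning

  block-% : ∀ b {o} → o < r → (b * r + o) % r ≡ o
  block-% b {o} o<r = trans (%-remove-+ˡ o (n∣m*n b)) (m<n⇒m%n≡m o<r)

  block-< : ∀ {b b′ o} o′ → b < b′ → o < r → b * r + o < b′ * r + o′
  block-< {b} {b′} {o} o′ b<b′ o<r = begin-strict
      b * r + o    <⟨ +-monoʳ-< (b * r) o<r ⟩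
      b * r + r    ≡⟨ +-comm (b * r) r ⟩
      suc b * r    ≤⟨ *-monoˡ-≤ r b<b′ ⟩
      b′ * r       ≤⟨ m≤m+n (b′ * r) o′ ⟩
      b′ * r + o′  ∎
    where open ≤-Reasoning

  block-far : ∀ {b b′ o o′} → b < b′ → o ≤ o′ → b * r + o + r ≤ b′ * r + o′
  block-far {b} {b′} {o} {o′} b<b′ o≤o′ = begin
      b * r + o + r    ≡⟨ +-assoc (b * r) o r ⟩
      b * r + (o + r)  ≡⟨ cong (b * r +_) (+-comm o r) ⟩
      b * r + (r + o)  ≡⟨ +-assoc (b * r) r o ⟨
      b * r + r + o    ≡⟨ cong (_+ o) (+-comm (b * r) r) ⟩
      suc b * r + o    ≤⟨ +-mono-≤ (*-monoˡ-≤ r b<b′) o≤o′ ⟩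
      b′ * r + o′      ∎
    where open ≤-Reasoning

  block-≤ : ∀ {b b′ o o′} → o′ < r → b * r + o ≤ b′ * r + o′ → b ≤ b′
  block-≤ {o = o} o′<r le = ≮⇒≥ (λ b′<b → <⇒≱ (block-< o b′<b o′<r) le)

  row : ℕ → ℕ
  row m = r′ ∸ m % r

  ypos : ℕ → ℕ → ℕ
  ypos b a = suc (b * r + a)

  idx : ℕ → ℕ
  idx m = ypos (row m) (m / r)

  %≤r′ : ∀ m → m % r ≤ r′
  %≤r′ m = s≤s⁻¹ (m%n<n m r)

  row<r : ∀ m → row m < r
  row<r m = s≤s (m∸n≤m r′ (m % r))

  /<r : ∀ {m} → m < N → m / r < r
  /<r m<N = m<n*o⇒m/o<n m<N

  gridP-idx : ∀ {m} → m < N → gridP r (idx m) ≡ (suc m , idx m)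
  gridP-idx {m} m<N = cong (_, idx m) (begin
      ((idx m ∸ 1) % r) * r + (r ∸ (idx m ∸ 1) / r)
        ≡⟨ cong₂ (λ a b → a * r + (r ∸ b)) (block-% (row m) (/<r m<N)) (block-/ (row m) (/<r m<N)) ⟩
      m / r * r + (r ∸ (r′ ∸ m % r))
        ≡⟨ cong (m / r * r +_) (trans (+-∸-assoc 1 (m∸n≤m r′ (m % r))) (cong suc (m∸[m∸n]≡n (%≤r′ m)))) ⟩
      m / r * r + suc (m % r)
        ≡⟨ +-suc _ _ ⟩
      suc (m / r * r + m % r)
        ≡⟨ cong suc (divmod m) ⟨
      suc m ∎)
    where open ≡-Reasoning

  idx≤N : ∀ {m} → m < N → idx m ≤ N
  idx≤N {m} m<N = subst (idx m ≤_) (+-identityʳ N) (block-< 0 (row<r m) (/<r m<N))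

  idx∈grid : ∀ {m} → m < N → idx m ∈ gridS r
  idx∈grid m<N = ∈-map⁺ suc (∈-upTo⁺ (idx≤N m<N))

  idx-injective : ∀ {m m′} → m < N → m′ < N → idx m ≡ idx m′ → m ≡ m′
  idx-injective m<N m′<N e =
    suc-injective (cong proj₁ (trans (sym (gridP-idx m<N)) (trans (cong (λ l → gridP r l) e) (gridP-idx m′<N))))

  idx-onto : ∀ {l} → l ∈ gridS r → ∃[ m ] (m < N × l ≡ idx m)
  idx-onto l∈ with ∈-map⁻ suc l∈
  ... | y , y∈ , refl = m , m<N , sym idx-m
    where
      y<N : y < N
      y<N = ∈-upTo⁻ y∈
      m : ℕ
      m = y % r * r + (r′ ∸ y / r)
      r′∸<r : r′ ∸ y / r < r
      r′∸<r = s≤s (m∸n≤m r′ (y / r))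
      m<N : m < N
      m<N = subst (m <_) (+-identityʳ N) (block-< 0 (m%n<n y r) r′∸<r)
      idx-m : idx m ≡ suc y
      idx-m = begin
          suc ((r′ ∸ m % r) * r + m / r)
            ≡⟨ cong₂ (λ s a → suc ((r′ ∸ s) * r + a)) (block-% (y % r) r′∸<r) (block-/ (y % r) r′∸<r) ⟩
          suc ((r′ ∸ (r′ ∸ y / r)) * r + y % r)
            ≡⟨ cong (λ b → suc (b * r + y % r)) (m∸[m∸n]≡n (s≤s⁻¹ (/<r y<N))) ⟩
          suc (y / r * r + y % r)
            ≡⟨ cong suc (divmod y) ⟨
          suc y ∎
        where open ≡-Reasoning

  Far : ℕ → ℕ → Set
  Far a b = a ⊓ b + r ≤ a ⊔ b

  far : ∀ {a b} → a + r ≤ b ⊎ b + r ≤ a → Far a b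
  far {a} {b} (inj₁ a+r≤b) =
    subst₂ (λ x y → x + r ≤ y) (sym (m≤n⇒m⊓n≡m a≤b)) (sym (m≤n⇒m⊔n≡n a≤b)) a+r≤b
    where
      a≤b : a ≤ b
      a≤b = ≤-trans (m≤m+n a r) a+r≤b
  far {a} {b} (inj₂ b+r≤a) =
    subst₂ (λ x y → x + r ≤ y) (sym (m≥n⇒m⊓n≡n b≤a)) (sym (m≥n⇒m⊔n≡m b≤a)) b+r≤a
    where
      b≤a : b ≤ a
      b≤a = ≤-trans (m≤m+n b r) b+r≤a

  far-suc : ∀ {m m′} → m + r ≤ m′ ⊎ m′ + r ≤ m → Far (suc m) (suc m′)
  far-suc {m} {m′} (inj₁ m+r≤m′) = far {suc m} {suc m′} (inj₁ (s≤s m+r≤m′))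
  far-suc {m} {m′} (inj₂ m′+r≤m) = far {suc m} {suc m′} (inj₂ (s≤s m′+r≤m))

  x-far : ∀ {m m′} → m / r < m′ / r → m % r ≤ m′ % r → m + r ≤ m′
  x-far {m} {m′} a<a′ s≤s′ = subst₂ (λ x y → x + r ≤ y) (sym (divmod m)) (sym (divmod m′)) (block-far a<a′ s≤s′)

  y-far : ∀ {m m′} → m′ % r < m % r → m / r ≤ m′ / r → idx m + r ≤ idx m′
  y-far {m} s′<s a≤a′ = s≤s (block-far (∸-monoʳ-< s′<s (%≤r′ m)) a≤a′)

  same-coords : ∀ {m m′} → m % r ≡ m′ % r → m / r ≡ m′ / r → m ≡ m′
  same-coords {m} {m′} s≡s′ a≡a′ = trans (divmod m) (trans (cong₂ (λ a s → a * r + s) a≡a′ s≡s′) (sym (divmod m′)))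

  separated : ∀ {m m′} → m ≢ m′ → Far (suc m) (suc m′) ⊎ Far (idx m) (idx m′)
  separated {m} {m′} m≢m′ with <-cmp (m / r) (m′ / r) | <-cmp (m % r) (m′ % r)
  ... | tri< a _ _ | tri< s _ _ = inj₁ (far-suc (inj₁ (x-far {m} {m′} a (<⇒≤ s))))
  ... | tri< a _ _ | tri≈ _ s _ = inj₁ (far-suc (inj₁ (x-far {m} {m′} a (≤-reflexive s))))
  ... | tri< a _ _ | tri> _ _ s = inj₂ (far {idx m} {idx m′} (inj₁ (y-far {m} {m′} s (<⇒≤ a))))
  ... | tri≈ _ a _ | tri< s _ _ = inj₂ (far {idx m} {idx m′} (inj₂ (y-far {m′} {m} s (≤-reflexive (sym a)))))
  ... | tri≈ _ a _ | tri≈ _ s _ = contradiction (same-coords s a) m≢m′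
  ... | tri≈ _ a _ | tri> _ _ s = inj₂ (far {idx m} {idx m′} (inj₁ (y-far {m} {m′} s (≤-reflexive a))))
  ... | tri> _ _ a | tri< s _ _ = inj₂ (far {idx m} {idx m′} (inj₂ (y-far {m′} {m} s (<⇒≤ a))))
  ... | tri> _ _ a | tri≈ _ s _ = inj₁ (far-suc (inj₂ (x-far {m′} {m} a (≤-reflexive (sym s)))))
  ... | tri> _ _ a | tri> _ _ s = inj₁ (far-suc (inj₂ (x-far {m′} {m} a (<⇒≤ s))))

  grid-separated : ∀ {i j} → i ∈ gridS r → j ∈ gridS r → i ≢ j →
                   ∃[ α ] Far (coord α (gridP r i)) (coord α (gridP r j))
  grid-separated i∈ j∈ i≢j with idx-onto i∈ | idx-onto j∈
  ... | m , m<N , refl | m′ , m′<N , refl rewrite gridP-idx m<N | gridP-idx m′<N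
    with separated (λ m≡m′ → i≢j (cong idx m≡m′))
  ... | inj₁ far-x = horizontal , far-x
  ... | inj₂ far-y = vertical , far-y

  coord≤N : ∀ α {l} → l ∈ gridS r → coord α (gridP r l) ≤ N
  coord≤N horizontal l∈ with idx-onto l∈
  ... | m , m<N , refl = subst (_≤ N) (sym (cong proj₁ (gridP-idx m<N))) m<N
  coord≤N vertical l∈ with ∈-map⁻ suc l∈
  ... | y , y∈ , refl = ∈-upTo⁻ y∈

  coord-onto : ∀ α {v} → 0 < v → v ≤ N → ∃[ l ] (l ∈ gridS r × coord α (gridP r l) ≡ v)
  coord-onto horizontal {suc v} _ v<N = idx v , idx∈grid v<N , cong proj₁ (gridP-idx v<N)
  coord-onto vertical   {suc v} _ v<N = suc v , ∈-map⁺ suc (∈-upTo⁺ v<N) , refl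

  -- After any merge of two grid points the new rectangle has view at least r′:
  -- along an axis where they are r apart, all r′ coordinates in between are taken.
  first-merge-view : ∀ {i j k G} → Merge (grid r) i j k G → r′ ≤ view G k
  first-merge-view {i} {j} {k} {G} M with grid-separated (Merge.i∈S M) (Merge.j∈S M) (Merge.i≢j M)
  ... | α , far-α = ≤-trans (views-gap r′ room fill) (countView≤view α G k)
    where
      open MergedPoints {gridS r} {gridP r} M α
      room : low + r′ < high
      room = subst (_≤ high) (+-suc low r′) far-α
      high≤N : high ≤ N
      high≤N = ⊔-lub (coord≤N α (Merge.i∈S M)) (coord≤N α (Merge.j∈S M))
      fill : ∀ {v} → low < v → v < high → ∃[ l ] (l ∈ gridS r × c l ≡ v)
      fill low<v v<high = coord-onto α (≤-<-trans z≤n low<v) (≤-trans (<⇒≤ v<high) high≤N)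

  width-lower : ∀ d → HasWideDecomp d (grid r) → r ≤ d
  width-lower d (step i j k _ _ M rest) =
    ≤-trans (s≤s (first-merge-view M)) (initial-wide rest k (∈-resp-↭ (↭-sym (Merge.domG M)) (here refl)))
  width-lower d (done w one) = subst (_≤ d) (sym r≡1) (≤-trans (s≤s z≤n) (w 1 (∈-map⁺ suc (∈-upTo⁺ (s≤s z≤n)))))
    where
      r≡1 : r ≡ 1
      r≡1 = m*n≡1⇒m≡1 r r (trans (sym (trans (length-map suc (upTo N)) (length-upTo N))) one)

  -- At
  -- stage t the family consists of r chains, ending at the x-ranks t, …, t + r′, and
  -- the points of x-rank ≥ t + r. The chain ending at m is the bounding box of the
  -- points of x-ranks m, m − r, m − 2r, …, which share the offset m % r and hence the
  -- row block row m. Stage t + 1 merges the chain ending at t with the point t + r.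
  chain : ℕ → Rect
  chain m = [ suc (m % r) , suc m ] , [ ypos (row m) 0 , idx m ]

  pointRect : ℕ → Rect
  pointRect m = point (suc m , idx m)

  chain-seed : ∀ {m} → m < r → chain m ≡ pointRect m
  chain-seed {m} m<r = cong₂ _,_ (cong (λ s → [ suc s , suc m ]) (m<n⇒m%n≡m m<r))
                                 (cong (λ a → [ ypos (row m) a , idx m ]) (sym (m<n⇒m/n≡0 m<r)))

  ypos-mono : ∀ b {a a′} → a ≤ a′ → ypos b a ≤ ypos b a′
  ypos-mono b a≤a′ = s≤s (+-monoʳ-≤ (b * r) a≤a′)

  -- Adding the point t + r to the chain ending at t gives the chain ending at t + r:
  -- same offset and row block, one column block further.
  chain-extend : ∀ t → bbox (chain t) (pointRect (t + r)) ≡ chain (t + r)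
  chain-extend t = begin
      bbox (chain t) (pointRect (t + r))
        ≡⟨ cong₂ _,_ (hull-right (s≤s (≤-trans (m%n≤m t r) (m≤m+n t r))) (s≤s (m≤m+n t r)))
                     (hull-right (≤-trans (ypos-mono (row t) z≤n) idx≤) idx≤) ⟩
      [ suc (t % r) , suc (t + r) ] , [ ypos (row t) 0 , idx (t + r) ]
        ≡⟨ cong (λ s → [ suc s , suc (t + r) ] , [ ypos (r′ ∸ s) 0 , idx (t + r) ]) (sym ([m+n]%n≡m%n t r)) ⟩
      chain (t + r) ∎
    where
      open ≡-Reasoning
      idx-step : idx (t + r) ≡ ypos (row t) (suc (t / r))
      idx-step = cong₂ (λ s a → ypos (r′ ∸ s) a) ([m+n]%n≡m%n t r)
                       (trans (m/n≡1+[m∸n]/n (m≤n+m r t)) (cong (λ x → suc (x / r)) (m+n∸n≡m t r)))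
      idx≤ : idx t ≤ idx (t + r)
      idx≤ = subst (idx t ≤_) (sym idx-step) (ypos-mono (row t) (n≤1+n (t / r)))

  band : ∀ {b b′ p o p′ o′} → o < r → o′ < r →
         T (meets [ ypos b p , ypos b o ] [ ypos b′ p′ , ypos b′ o′ ]) → b ≡ b′
  band {b} {b′} {p} {o} {p′} {o′} o<r o′<r met
    with meets⁻ [ ypos b p , ypos b o ] [ ypos b′ p′ , ypos b′ o′ ] met
  ... | lo≤hi′ , lo′≤hi = ≤-antisym (block-≤ o′<r (s≤s⁻¹ lo≤hi′)) (block-≤ o<r (s≤s⁻¹ lo′≤hi))

  row-injective : ∀ {m m′} → row m ≡ row m′ → m % r ≡ m′ % r
  row-injective {m} {m′} = ∸-cancelˡ-≡ (%≤r′ m) (%≤r′ m′)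

  offset-order : ∀ {m m′} → m % r ≡ m′ % r → m / r ≤ m′ / r → m ≤ m′
  offset-order {m} {m′} s≡s′ a≤a′ = subst₂ _≤_ (sym (divmod m)) (sym (divmod m′))
                                      (+-mono-≤ (*-monoˡ-≤ r a≤a′) (≤-reflexive s≡s′))

  offset-gap : ∀ {m m′} → m % r ≡ m′ % r → m < m′ → m + r ≤ m′
  offset-gap {m} {m′} s≡s′ m<m′ with <-cmp (m / r) (m′ / r)
  ... | tri< a<a′ _ _ = x-far a<a′ (≤-reflexive s≡s′)
  ... | tri≈ _ a≡a′ _ = contradiction (same-coords s≡s′ a≡a′) (<⇒≢ m<m′)
  ... | tri> _ _ a′<a = contradiction (offset-order (sym s≡s′) (<⇒≤ a′<a)) (<⇒≱ m<m′)

  window : ∀ {t m m′} → m % r ≡ m′ % r → t ≤ m → m < t + r → t ≤ m′ → m′ < t + r → m ≡ m′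
  window {t} {m} {m′} s≡s′ t≤m m<t+r t≤m′ m′<t+r with <-cmp m m′
  ... | tri< m<m′ _ _ = contradiction (≤-<-trans (offset-gap s≡s′ m<m′) m′<t+r) (≤⇒≯ (+-monoˡ-≤ r t≤m))
  ... | tri≈ _ m≡m′ _ = m≡m′
  ... | tri> _ _ m′<m = contradiction (≤-<-trans (offset-gap (sym s≡s′) m′<m) m<t+r) (≤⇒≯ (+-monoˡ-≤ r t≤m′))

  -- The index of the chain ending at m: the grid point itself when m < r, and
  -- otherwise N + t + 1, the index introduced at stage t + 1 with t = m − r.
  chainIdx : ℕ → ℕ
  chainIdx m with m <? r
  ... | yes _ = idx m
  ... | no _  = suc (N + (m ∸ r))

  chainIdx-seed : ∀ {m} → m < r → chainIdx m ≡ idx m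
  chainIdx-seed {m} m<r with m <? r
  ... | yes _  = refl
  ... | no m≮r = contradiction m<r m≮r

  chainIdx-new : ∀ t → chainIdx (t + r) ≡ suc (N + t)
  chainIdx-new t with t + r <? r
  ... | yes t+r<r = contradiction t+r<r (≤⇒≯ (m≤n+m r t))
  ... | no _      = cong (λ x → suc (N + x)) (m+n∸n≡m t r)

  idx≢new : ∀ {m} x → m < N → idx m ≢ suc (N + x)
  idx≢new x m<N = <⇒≢ (s≤s (≤-trans (idx≤N m<N) (m≤m+n N x)))

  -- The chains of stage t have indices at most N + t, so N + t + 1 is fresh.
  chainIdx-bound : ∀ {t m} → t + r ≤ N → m < t + r → chainIdx m ≤ N + t
  chainIdx-bound {t} {m} t+r≤N m<t+r with m <? r
  ... | yes _  = ≤-trans (idx≤N (<-≤-trans m<t+r t+r≤N)) (m≤m+n N t)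
  ... | no m≮r = subst (_≤ N + t) (+-suc N (m ∸ r))
                   (+-monoʳ-≤ N (subst (m ∸ r <_) (m+n∸n≡m t r) (∸-monoˡ-< m<t+r (≮⇒≥ m≮r))))

  chainIdx-injective : ∀ {m m′} → m < N → m′ < N → chainIdx m ≡ chainIdx m′ → m ≡ m′
  chainIdx-injective {m} {m′} m<N m′<N e with m <? r | m′ <? r
  ... | yes _  | yes _   = idx-injective m<N m′<N e
  ... | yes _  | no _    = contradiction e (idx≢new (m′ ∸ r) m<N)
  ... | no _   | yes _   = contradiction (sym e) (idx≢new (m ∸ r) m′<N)
  ... | no m≮r | no m′≮r = ∸-cancelʳ-≡ (≮⇒≥ m≮r) (≮⇒≥ m′≮r) (+-cancelˡ-≡ N _ _ (suc-injective e))

  chainIdx≢idx : ∀ {m m′} → m < m′ → m′ < N → chainIdx m ≢ idx m′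
  chainIdx≢idx {m} {m′} m<m′ m′<N e with m <? r
  ... | yes _ = <⇒≢ m<m′ (idx-injective (<-trans m<m′ m′<N) m′<N e)
  ... | no _  = idx≢new (m ∸ r) m′<N (sym e)

  stage : ℕ → Family
  stage zero    = grid r
  stage (suc t) = merge (stage t) (chainIdx t) (idx (t + r)) (suc (N + t))

  -- The intended members of stage t, with their intended rectangles.
  data Piece (t : ℕ) : ℕ → Set where
    chainᵖ : ∀ {m} → t ≤ m → m < t + r → Piece t (chainIdx m)
    pointᵖ : ∀ {m} → t + r ≤ m → m < N → Piece t (idx m)

  shape : ∀ {t l} → Piece t l → Rect
  shape (chainᵖ {m} _ _) = chain m
  shape (pointᵖ {m} _ _) = pointRect m

  piece-bound : ∀ {t l} → t + r ≤ N → Piece t l → l ≤ N + t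
  piece-bound t+r≤N (chainᵖ _ m<t+r) = chainIdx-bound t+r≤N m<t+r
  piece-bound {t} _  (pointᵖ _ m<N)  = ≤-trans (idx≤N m<N) (m≤m+n N t)

  -- A chain ending before x-rank m′ shares no y-coordinate with the point m′: in
  -- the same row block, that point would sit in a column no later than the chain's end.
  chain-point-y-apart : ∀ {t m m′} → t + r ≤ N → m < t + r → t + r ≤ m′ → m′ < N →
                        ¬ T (meets (I₂ (chain m)) (I₂ (pointRect m′)))
  chain-point-y-apart {m = m} {m′} t+r≤N m<t+r t+r≤m′ m′<N met =
    <⇒≱ (<-≤-trans m<t+r t+r≤m′) (offset-order (sym (row-injective {m} {m′} same-row)) a′≤a)
    where
      same-row : row m ≡ row m′
      same-row = band {row m} {row m′} {0} {m / r} {m′ / r} (/<r (<-≤-trans m<t+r t+r≤N)) (/<r m′<N) met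
      a′≤a : m′ / r ≤ m / r
      a′≤a = +-cancelˡ-≤ (row m * r) _ _
               (subst (λ b → b * r + m′ / r ≤ row m * r + m / r) (sym same-row)
                      (s≤s⁻¹ (proj₂ (meets⁻ (I₂ (chain m)) (I₂ (pointRect m′)) met))))

  -- Distinct pieces never share a y-coordinate: they live in different row blocks,
  -- or in the same row block at different columns.
  y-apart : ∀ {t l j} → t + r ≤ N → (p : Piece t l) (q : Piece t j) → l ≢ j →
            ¬ T (meets (I₂ (shape p)) (I₂ (shape q)))
  y-apart t+r≤N (chainᵖ {m} t≤m m<t+r) (chainᵖ {m′} t≤m′ m′<t+r) l≢j met =
    l≢j (cong chainIdx (window (row-injective {m} {m′} same-row) t≤m m<t+r t≤m′ m′<t+r))
    where
      same-row : row m ≡ row m′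
      same-row = band {row m} {row m′} {0} {m / r} {0} (/<r (<-≤-trans m<t+r t+r≤N))
                                                      (/<r (<-≤-trans m′<t+r t+r≤N)) met
  y-apart t+r≤N (chainᵖ _ m<t+r) (pointᵖ t+r≤m′ m′<N) _ met =
    chain-point-y-apart t+r≤N m<t+r t+r≤m′ m′<N met
  y-apart t+r≤N (pointᵖ {m} t+r≤m m<N) (chainᵖ {m′} _ m′<t+r) _ met =
    chain-point-y-apart t+r≤N m′<t+r t+r≤m m<N (meets-sym (I₂ (pointRect m)) (I₂ (chain m′)) met)
  y-apart _ (pointᵖ {m} _ _) (pointᵖ {m′} _ _) l≢j met = l≢j (points-meet (idx m) (idx m′) met)

  -- A point piece shares no x-coordinate with any other piece: every chain ends
  -- strictly to its left.
  point-x-apart : ∀ {t m j} → t + r ≤ m → (q : Piece t j) → idx m ≢ j →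
                  ¬ T (meets (I₁ (pointRect m)) (I₁ (shape q)))
  point-x-apart {m = m} t+r≤m (chainᵖ {m′} _ m′<t+r) _ met =
    <⇒≱ (<-≤-trans m′<t+r t+r≤m) (s≤s⁻¹ (proj₁ (meets⁻ (I₁ (pointRect m)) (I₁ (chain m′)) met)))
  point-x-apart {m = m} _ (pointᵖ {m′} _ _) l≢j met =
    l≢j (cong idx (suc-injective (points-meet (suc m) (suc m′) met)))

  record Invariant (t : ℕ) : Set where
    field
      members  : ∀ {l} → l ∈ dom (stage t) → Piece t l
      complete : ∀ {l} → Piece t l → l ∈ dom (stage t)
      distinct : Unique (dom (stage t))
      shapes   : ∀ {l} (p : Piece t l) → rect (stage t) l ≡ shape p

  -- Stage 0 is the grid itself: its points of x-rank < r are the one-point chains.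
  invariant-zero : Invariant 0
  invariant-zero = record
    { members  = members
    ; complete = complete
    ; distinct = Unique.map⁺ suc-injective (Unique.upTo⁺ N)
    ; shapes   = shapes }
    where
      <r⇒<N : ∀ {m} → m < r → m < N
      <r⇒<N m<r = <-≤-trans m<r (m≤m*n r r)
      members : ∀ {l} → l ∈ gridS r → Piece 0 l
      members l∈ with idx-onto l∈
      ... | m , m<N , refl with m <? r
      ...   | yes m<r = subst (Piece 0) (chainIdx-seed m<r) (chainᵖ z≤n m<r)
      ...   | no m≮r  = pointᵖ (≮⇒≥ m≮r) m<N
      complete : ∀ {l} → Piece 0 l → l ∈ gridS r
      complete (chainᵖ _ m<r) = subst (_∈ gridS r) (sym (chainIdx-seed m<r)) (idx∈grid (<r⇒<N m<r))
      complete (pointᵖ _ m<N) = idx∈grid m<N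
      shapes : ∀ {l} (p : Piece 0 l) → point (gridP r l) ≡ shape p
      shapes (chainᵖ {m} _ m<r) = begin
          point (gridP r (chainIdx m))  ≡⟨ cong (λ l → point (gridP r l)) (chainIdx-seed m<r) ⟩
          point (gridP r (idx m))       ≡⟨ cong point (gridP-idx (<r⇒<N m<r)) ⟩
          pointRect m                   ≡⟨ chain-seed m<r ⟨
          chain m                       ∎
        where open ≡-Reasoning
      shapes (pointᵖ _ m<N) = cong point (gridP-idx m<N)

  module Step {t} (t+r<N : t + r < N) (I : Invariant t) where
    open Invariant I

    t+r≤N : t + r ≤ N
    t+r≤N = <⇒≤ t+r<N

    t<t+r : t < t + r
    t<t+r = m<m+n t z<s

    new : ℕ
    new = suc (N + t)

    fresh : new ∉ dom (stage t)
    fresh new∈ = 1+n≰n (piece-bound t+r≤N (members new∈))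

    merged : Merge (stage t) (chainIdx t) (idx (t + r)) new (stage (suc t))
    merged = merge-isMerge (complete (chainᵖ ≤-refl t<t+r)) (complete (pointᵖ ≤-refl t+r<N))
                           (chainIdx≢idx t<t+r t+r<N) fresh

    survivor : ∀ {l} → l ∈ dom (stage t) → l ≢ chainIdx t → l ≢ idx (t + r) → l ∈ dom (stage (suc t))
    survivor {l} l∈ l≢i l≢j =
      there (∈-filter⁺ (T? ∘ keepOthers (chainIdx t) (idx (t + r))) l∈ (keepOthers⁺ {chainIdx t} {idx (t + r)} {l} l≢i l≢j))

    unchanged : ∀ {l} → Piece t l → rect (stage (suc t)) l ≡ rect (stage t) l
    unchanged p = merge-rect-old (stage t) (chainIdx t) (idx (t + r)) new (<⇒≢ (s≤s (piece-bound t+r≤N p)))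

    members′ : ∀ {l} → l ∈ dom (stage (suc t)) → Piece (suc t) l
    members′ (here refl) = subst (Piece (suc t)) (chainIdx-new t) (chainᵖ t<t+r (n<1+n (t + r)))
    members′ {l} (there l∈) with ∈-filter⁻ (T? ∘ keepOthers (chainIdx t) (idx (t + r))) l∈
    ... | l∈t , kept with keepOthers⁻ {chainIdx t} {idx (t + r)} {l} kept | members l∈t
    ... | l≢i , _ | chainᵖ t≤m m<t+r = chainᵖ (≤∧≢⇒< t≤m (λ t≡m → l≢i (cong chainIdx (sym t≡m)))) (m<n⇒m<1+n m<t+r)
    ... | _ , l≢j | pointᵖ t+r≤m m<N = pointᵖ (≤∧≢⇒< t+r≤m (λ e → l≢j (cong idx (sym e)))) m<N

    -- Conversely every piece of stage t + 1 is present, since distinct pieces have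
    -- distinct indices.
    complete′ : ∀ {l} → Piece (suc t) l → l ∈ dom (stage (suc t))
    complete′ (chainᵖ {m} t<m m≤t+r) with m≤n⇒m<n∨m≡n (s≤s⁻¹ m≤t+r)
    ... | inj₂ refl  = here (chainIdx-new t)
    ... | inj₁ m<t+r = survivor {chainIdx m} (complete (chainᵖ (<⇒≤ t<m) m<t+r))
        (λ e → <⇒≢ t<m (sym (chainIdx-injective (<-trans m<t+r t+r<N) (<-trans t<t+r t+r<N) e)))
        (chainIdx≢idx m<t+r t+r<N)
    complete′ (pointᵖ {m} t+r<m m<N) = survivor {idx m} (complete (pointᵖ (<⇒≤ t+r<m) m<N))
        (λ e → chainIdx≢idx (<-trans t<t+r t+r<m) m<N (sym e))
        (λ e → <⇒≢ t+r<m (sym (idx-injective m<N t+r<N e)))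

    distinct′ : Unique (dom (stage (suc t)))
    distinct′ = All.tabulate new∉ ∷ Unique.filter⁺ (T? ∘ keepOthers (chainIdx t) (idx (t + r))) distinct
      where
        new∉ : ∀ {l} → l ∈ filterᵇ (keepOthers (chainIdx t) (idx (t + r))) (dom (stage t)) → new ≢ l
        new∉ l∈ refl = fresh (proj₁ (∈-filter⁻ (T? ∘ keepOthers (chainIdx t) (idx (t + r))) l∈))

    shapes′ : ∀ {l} (p : Piece (suc t) l) → rect (stage (suc t)) l ≡ shape p
    shapes′ (chainᵖ {m} t<m m≤t+r) with m≤n⇒m<n∨m≡n (s≤s⁻¹ m≤t+r)
    ... | inj₂ refl = begin
        rect (stage (suc t)) (chainIdx (t + r))
          ≡⟨ cong (rect (stage (suc t))) (chainIdx-new t) ⟩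
        rect (stage (suc t)) new
          ≡⟨ merge-rect-new (stage t) (chainIdx t) (idx (t + r)) new ⟩
        bbox (rect (stage t) (chainIdx t)) (rect (stage t) (idx (t + r)))
          ≡⟨ cong₂ bbox (shapes (chainᵖ ≤-refl t<t+r)) (shapes (pointᵖ ≤-refl t+r<N)) ⟩
        bbox (chain t) (pointRect (t + r))
          ≡⟨ chain-extend t ⟩
        chain (t + r) ∎
      where open ≡-Reasoning
    ... | inj₁ m<t+r = let p = chainᵖ (<⇒≤ t<m) m<t+r in trans (unchanged p) (shapes p)
    shapes′ (pointᵖ t+r<m m<N) = let p = pointᵖ (<⇒≤ t+r<m) m<N in trans (unchanged p) (shapes p)

    invariant′ : Invariant (suc t)
    invariant′ = record { members = members′ ; complete = complete′ ; distinct = distinct′ ; shapes = shapes′ }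

  invariant : ∀ t → t + r ≤ N → Invariant t
  invariant zero    _     = invariant-zero
  invariant (suc t) t+r<N = Step.invariant′ t+r<N (invariant t (<⇒≤ t+r<N))

  chains : ℕ → List ℕ
  chains t = map (λ s → chainIdx (t + s)) (upTo r)

  length-chains : ∀ t → length (chains t) ≡ r
  length-chains t = trans (length-map _ (upTo r)) (length-upTo r)

  chain∈chains : ∀ {t m} → t ≤ m → m < t + r → chainIdx m ∈ chains t
  chain∈chains {t} {m} t≤m m<t+r = subst (_∈ chains t) (cong chainIdx (m+[n∸m]≡n t≤m))
    (∈-map⁺ (λ s → chainIdx (t + s)) (∈-upTo⁺ (subst (m ∸ t <_) (m+n∸m≡n t r) (∸-monoˡ-< m<t+r t≤m))))

  -- Every stage is r-wide: no piece sees another one vertically, and horizontally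
  -- a point sees nothing while a chain sees only the other chains.
  stage-wide : ∀ {t} → t + r ≤ N → Invariant t → Wide r (stage t)
  stage-wide {t} t+r≤N I l l∈ = piece-view (members l∈)
    where
      open Invariant I

      seen : ∀ {Iα l j} (p : Piece t l) → j ∈ viewers Iα (stage t) l →
             Σ (Piece t j) λ q → l ≢ j × T (meets (Iα (shape p)) (Iα (shape q)))
      seen {Iα} {l} p v∈ with ∈-viewers⁻ {Iα} {stage t} {l} v∈
      ... | j∈ , j≢l , met = members j∈ , j≢l ∘ sym ,
            subst₂ (λ R R′ → T (meets (Iα R) (Iα R′))) (shapes p) (shapes (members j∈)) met

      unseen : ∀ {Iα l} → (∀ {j} → j ∉ viewers Iα (stage t) l) → countView Iα (stage t) l < r
      unseen {Iα} {l} none =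
        <-≤-trans (countView-< {Iα} {stage t} {l} {l ∷ []} distinct (here refl) (λ v∈ → contradiction v∈ none)) (s≤s z≤n)

      x-view : ∀ {l} (p : Piece t l) → countView I₁ (stage t) l < r
      x-view {l} p@(chainᵖ t≤m m<t+r) =
        subst (countView I₁ (stage t) l <_) (length-chains t)
              (countView-< {I₁} {stage t} {l} distinct (chain∈chains t≤m m<t+r) (λ v∈ → sees-chain (seen {I₁} p v∈)))
        where
          sees-chain : ∀ {j} → Σ (Piece t j) (λ q → l ≢ j × T (meets (I₁ (shape p)) (I₁ (shape q)))) → j ∈ chains t
          sees-chain (chainᵖ t≤m′ m′<t+r , _) = chain∈chains t≤m′ m′<t+r
          sees-chain (q@(pointᵖ t+r≤m′ _) , l≢j , met) =
            contradiction (meets-sym (I₁ (shape p)) (I₁ (shape q)) met) (point-x-apart t+r≤m′ p (l≢j ∘ sym))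
      x-view p@(pointᵖ t+r≤m _) =
        unseen {I₁} (λ v∈ → let (q , l≢j , met) = seen {I₁} p v∈ in point-x-apart t+r≤m q l≢j met)

      piece-view : ∀ {l} → Piece t l → view (stage t) l < r
      piece-view p = ⊔-lub (x-view p)
                           (unseen {I₂} (λ v∈ → let (q , l≢j , met) = seen {I₂} p v∈ in y-apart t+r≤N p q l≢j met))

  -- The sweep, started at stage t with s steps to go: once only the r chains are
  -- left, they are merged in any order.
  sweep : ∀ s t → s + t + r ≡ N → WideDecompFrom r (N + t) (stage t)
  sweep zero t end = finish (N + t) (stage t) (complete (chainᵖ ≤-refl (m<m+n t z<s))) distinct few bounded
    where
      open Invariant (invariant t (≤-reflexive end))
      only-chains : ∀ {l} → l ∈ dom (stage t) → l ∈ chains t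
      only-chains l∈ with members l∈
      ... | chainᵖ t≤m m<t+r  = chain∈chains t≤m m<t+r
      ... | pointᵖ t+r≤m m<N = contradiction (<-≤-trans m<N (≤-reflexive (sym end))) (≤⇒≯ t+r≤m)
      few : length (dom (stage t)) ≤ r
      few = subst (length (dom (stage t)) ≤_) (length-chains t) (unique-⊆-length distinct only-chains)
      bounded : ∀ {l} → l ∈ dom (stage t) → l ≤ N + t
      bounded = piece-bound (≤-reflexive end) ∘ members
  sweep (suc s) t end =
    step (chainIdx t) (idx (t + r)) (suc (N + t)) (stage-wide (<⇒≤ t+r<N) I) ≤-refl (Step.merged t+r<N I)
      (subst (λ b → WideDecompFrom r b (stage (suc t))) (+-suc N t) (sweep s (suc t) (trans (cong (_+ r) (+-suc s t)) end)))
    where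
      t+r<N : t + r < N
      t+r<N = subst (t + r <_) end (s≤s (+-monoˡ-≤ r (m≤n+m t s)))
      I : Invariant t
      I = invariant t (<⇒≤ t+r<N)

  width-upper : HasWideDecomp r (grid r)
  width-upper = lower-start (maxList-≤ (gridS r) grid≤N) (sweep (N ∸ r) 0 start)
    where
      grid≤N : ∀ {l} → l ∈ gridS r → l ≤ N + 0
      grid≤N {l} l∈ = subst (l ≤_) (sym (+-identityʳ N)) (coord≤N vertical l∈)
      start : N ∸ r + 0 + r ≡ N
      start = trans (cong (_+ r) (+-identityʳ (N ∸ r))) (m∸n+n≡m (m≤m*n r r))

proposition5 : (r : ℕ) → .{{_ : NonZero r}} → WidthIs (grid r) r
proposition5 zero     = contradiction refl (≢-nonZero⁻¹ 0)
proposition5 (suc r′) = width-upper , width-lower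
  where open Grid r′
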